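{- The positional marked patterns $\underline{1}23$ and $\underline{1}32$ are $pmp$-Wilf equivalent; that is, for every $n\ge 1$, $$\sum_{\sigma\in S_n} x^{pmp_{\underline{1}23}(\sigma)}=\sum_{\sigma\in S_n} x^{pmp_{\underline{1}32}(\sigma)}.$$
   Context: A positional marked pattern of length $k$ is a permutation $\tau=\tau_1\cdots\tau_k$ of $[k]$ with exactly one entry underlined; $\pi(\tau)\in S_k$ is the permutation obtained by removing the underline and $u(\tau)$ is the position of the underlined entry. For a word $w$ with distinct letters, $red(w)$ replaces the $i$-th smallest letter by $i$. For $\sigma=\sigma_1\cdots\sigma_n\in S_n$, $\sigma$ has a $\tau$-match at position $\ell$ if there are indices $i_1<\cdots<i_k$ with $i_{u(\tau)}=\ell$ and $red(\sigma_{i_1}\cdots\sigma_{i_k})=\pi(\tau)$. $pmp_\tau(\sigma)$ is the number of positions $\ell$ at which $\sigma$ has a $\tau$-match. Two positional marked patterns $\tau,\tau'$ are $pmp$-Wilf equivalent if $\sum_{\sigma\in S_n}x^{pmp_\tau(\sigma)}=\sum_{\sigma\in S_n}x^{pmp_{\tau'}(\sigma)}$ for all $n$. Thus $\underline{1}23$ is the pattern with $\pi=123$, $u=1$, and $\underline{1}32$ the pattern with $\pi=132$, $u=1$. -}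

module Defs where

open import Data.Nat using (ℕ; zero; suc; _≤ᵇ_; _<ᵇ_; _≡ᵇ_)
open import Data.Bool using (Bool; true; false; _∧_; if_then_else_)
open import Data.Fin using (Fin; toℕ; zero)
open import Data.Fin.Properties using (_≟_)
open import Data.List using (List; []; _∷_; [_]; map; concatMap; filter; length; allFin)
open import Data.Bool.ListAction using (all; any)
open import Data.Vec as Vec using (Vec; lookup; toList)
open import Relation.Nullary.Decidable using (⌊_⌋)
open import Data.Bool using (T?)
open import Relation.Binary.PropositionalEquality using (_≡_)

allWords : (len m : ℕ) → List (Vec (Fin m) len)
allWords zero    m = [ Vec.[] ]
allWords (suc l) m = concatMap (λ x → map (x Vec.∷_) (allWords l m)) (allFin m)

distinctᵇ : ∀ {m len} → Vec (Fin m) len → Bool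
distinctᵇ {m} {len} w =
  all (λ a → all (λ b → if ⌊ a ≟ b ⌋ then true
                        else (if ⌊ lookup w a ≟ lookup w b ⌋ then false else true))
                 (allFin len))
      (allFin len)

increasingᵇ : ∀ {m len} → Vec (Fin m) len → Bool
increasingᵇ {m} {len} w =
  all (λ a → all (λ b → if toℕ a <ᵇ toℕ b then toℕ (lookup w a) <ᵇ toℕ (lookup w b) else true)
                 (allFin len))
      (allFin len)

-- S_n : permutations of [n] in one-line notation σ₁⋯σₙ (letters 0-based in Fin n).
Perm : ℕ → Set
Perm n = Vec (Fin n) n

S : (n : ℕ) → List (Perm n)
S n = filter (λ w → T? (distinctᵇ w)) (allWords n n)

incTuples : (k n : ℕ) → List (Vec (Fin n) k)
incTuples k n = filter (λ w → T? (increasingᵇ w)) (allWords k n)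

-- red(w): replace the i-th smallest letter by i (values 1-based, as in the paper):
-- red(w)_a = #{ b : w_b ≤ w_a }  (for words with distinct letters).
red : ∀ {m k} → Vec (Fin m) k → Vec ℕ k
red {m} {k} w = Vec.tabulate (λ a → length (filter (λ b → Data.Nat._≤?_ (toℕ (lookup w b)) (toℕ (lookup w a))) (allFin k)))

-- Positional marked pattern of length k: π(τ) ∈ S_k in one-line notation with
-- values in {1,…,k}, and the (0-based) position u(τ) of the underlined entry.
record PMPattern (k : ℕ) : Set where
  constructor pmpat
  field
    π : Vec ℕ k
    u : Fin k
open PMPattern public

vecEqᵇ : ∀ {k} → Vec ℕ k → Vec ℕ k → Bool
vecEqᵇ Vec.[] Vec.[] = true
vecEqᵇ (x Vec.∷ xs) (y Vec.∷ ys) = (x ≡ᵇ y) ∧ vecEqᵇ xs ys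

hasMatchᵇ : ∀ {k n} → PMPattern k → Perm n → Fin n → Bool
hasMatchᵇ {k} {n} τ σ ℓ =
  any (λ i → ⌊ lookup i (u τ) ≟ ℓ ⌋ ∧ vecEqᵇ (red (Vec.map (lookup σ) i)) (π τ))
      (incTuples k n)

pmp : ∀ {k n} → PMPattern k → Perm n → ℕ
pmp {k} {n} τ σ = length (filter (λ ℓ → T? (hasMatchᵇ τ σ ℓ)) (allFin n))

-- Coefficient of x^j in the polynomial  ∑_{σ ∈ S_n} x^{pmp_τ(σ)}.
pmpPolyCoeff : ∀ {k} → PMPattern k → (n j : ℕ) → ℕ
pmpPolyCoeff τ n j = length (filter (λ σ → Data.Nat._≟_ (pmp τ σ) j) (S n))

-- Two polynomials in ℕ[x] are equal iff all coefficients agree.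
pmpWilfEquivAt : ∀ {k k'} → PMPattern k → PMPattern k' → ℕ → Set
pmpWilfEquivAt τ τ' n = ∀ j → pmpPolyCoeff τ n j ≡ pmpPolyCoeff τ' n j

pat-1̲23 : PMPattern 3
pat-1̲23 = pmpat (1 Vec.∷ 2 Vec.∷ 3 Vec.∷ Vec.[]) zero

pat-1̲32 : PMPattern 3
pat-1̲32 = pmpat (1 Vec.∷ 3 Vec.∷ 2 Vec.∷ Vec.[]) zero

-- Write a permutation of [n+1] as x ⊕ ρ: its first letter x followed by a permutation ρ of [n]
-- relabelled by punchIn x. Relabelling preserves the order of letters, so every later position keeps
-- its status and pmp (x ⊕ ρ) = pmp ρ + [the first position is a match]. For 1̲23 (resp. 1̲32) the
-- first position is a match iff x < b ρ, where b ρ is 1 + the largest letter of ρ that is followed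
-- (resp. preceded) by a larger letter of ρ. The threshold b (x ⊕ ρ) is in turn an explicit function
-- of x, n and b ρ, so the pairs (b, pmp) over S (n+1) arise from those over S n by explicit
-- transition rules. For a fixed pair (b, s) with b ≤ n the two rules produce the same multiset of
-- successors as x runs over [0..n], so by induction the multisets of pairs over S n coincide, and
-- with them the distributions of pmp.

{-# OPTIONS --safe #-}
module Submission where

open import Defs
open import Data.Bool using (Bool; true; false; T; T?; _∧_; _∨_; if_then_else_)
open import Data.Bool.ListAction using (all)
open import Data.Bool.Properties using (T-∧; T-∨; T-≡)
open import Data.Fin as Fin using (Fin; zero; suc; toℕ; #_; punchIn; punchOut; fromℕ; inject₁)
open import Data.Fin.Properties
  using (punchIn-mono-≤; punchIn-cancel-≤; punchIn-injective; punchIn-punchOut; suc-injective;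
         toℕ<n; toℕ-fromℕ; toℕ-inject₁)
open import Data.List as List
  using (List; []; _∷_; [_]; _++_; _∷ʳ_; length; filter; allFin; map; concatMap; applyUpTo; upTo)
open import Data.List.Membership.Propositional using (_∈_; lose; find)
open import Data.List.Membership.Propositional.Properties
  using (∈-allFin; ∈-filter⁺; ∈-filter⁻; ∈-map⁺; ∈-map⁻; ∈-concat⁺′; ∈-concatMap⁻)
open import Data.List.Properties
  using (length-filter; filter-some; filter-accept; filter-reject; filter-none; filter-all; filter-≐; filter-++;
         length-tabulate; length-map; map-tabulate; map-∘; map-++; map-cong-local; map-applyUpTo; applyUpTo-∷ʳ;
         concatMap-cong; concatMap-map; map-concatMap)
open import Data.List.Relation.Binary.Permutation.Propositional
  using (_↭_; ↭-refl; ↭-reflexive; ↭-sym; ↭-trans; prep; module PermutationReasoning)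
import Data.List.Relation.Binary.Permutation.Propositional as ↭
open import Data.List.Relation.Binary.Permutation.Propositional.Properties
  using (++⁺ˡ; ++⁺; shifts; ∷↭∷ʳ; ↭-length; filter-↭)
open import Data.List.Relation.Binary.Sublist.Propositional using (⊆-refl)
open import Data.List.Relation.Binary.Sublist.Propositional.Properties using (filter⁺; length-mono-≤)
import Data.List.Relation.Unary.All as All
open import Data.List.Relation.Unary.All.Properties using (all⁺; all⁻)
open import Data.List.Relation.Unary.Any using (here; there)
open import Data.List.Relation.Unary.Any.Properties using (any⁺; any⁻)
open import Data.Nat using (ℕ; zero; suc; _+_; _⊔_; _≤_; _<_; _≤?_; _≤ᵇ_; _<ᵇ_; _≟_; z≤n; s≤s; s≤s⁻¹; z<s; s<s)
open import Data.Nat.Properties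
  using (≤-refl; ≤-reflexive; ≤-trans; ≤-antisym; <-trans; <-irrefl; <⇒≤; <⇒≱; ≰⇒>; <-≤-trans;
         n<1+n; n≤1+n; m≤n⇒m≤1+n; m≤m+n; +-suc; +-identityʳ; +-monoʳ-<; m≤n⇒∃[o]m+o≡n;
         ⊔-sel; ⊔-lub; m≤m⊔n; m≤n⊔m; m<n⇒m<n⊔o; m<n⇒m<o⊔n; m≤n⇒m⊔n≡n; m≥n⇒m⊔n≡m; mono-≤-distrib-⊔;
         <ᵇ⇒<; <⇒<ᵇ; ≡ᵇ⇒≡; ≡⇒≡ᵇ; <ᵇ-reflects-<; ≤ᵇ-reflects-≤)
open import Data.Product using (_×_; _,_; proj₁; proj₂; ∃; ∃₂)
open import Data.Product.Function.NonDependent.Propositional using (_×-⇔_)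
open import Data.Sum using (_⊎_; inj₁; inj₂; [_,_]′)
open import Data.Sum.Function.Propositional using (_⊎-⇔_)
open import Data.Unit using (tt)
open import Data.Vec as Vec using (Vec; []; _∷_; lookup)
open import Data.Vec.Properties using (lookup∘tabulate; lookup-map)
import Data.Vec.Relation.Unary.All as VecAll
open import Data.Vec.Relation.Unary.All.Properties using (lookup⁺; lookup⁻)
open import Function using (id; _∘_; _⇔_; mk⇔; Equivalence)
open import Function.Definitions using (Injective)
open import Function.Properties.Equivalence using () renaming (refl to ⇔-refl; sym to ⇔-sym; trans to ⇔-trans)
import Function.Related.Propositional as Related
open import Relation.Nullary using (¬_; Dec; yes; no; does; ofʸ; ofⁿ; contradiction; ¬?; _×-dec_)
open import Relation.Nullary.Decidable using (⌊_⌋; toWitness; fromWitness)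
open import Relation.Unary using (Decidable; _⊆_)
open import Relation.Binary.PropositionalEquality
  using (_≡_; _≢_; refl; sym; trans; cong; cong₂; subst; module ≡-Reasoning)

T-injective : ∀ {a b} → T a ⇔ T b → a ≡ b
T-injective {false} {false} _ = refl
T-injective {true}  {true}  _ = refl
T-injective {true}  {false} a⇔b = contradiction (Equivalence.to a⇔b tt) λ ()
T-injective {false} {true}  a⇔b = contradiction (Equivalence.from a⇔b tt) λ ()

T-<ᵇ : ∀ {m n} → T (m <ᵇ n) ⇔ m < n
T-<ᵇ = mk⇔ (<ᵇ⇒< _ _) <⇒<ᵇ

<ᵇ-true : ∀ {m n} → m < n → (m <ᵇ n) ≡ true
<ᵇ-true m<n = Equivalence.to T-≡ (<⇒<ᵇ m<n)

<ᵇ-false : ∀ {m n} → n ≤ m → (m <ᵇ n) ≡ false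
<ᵇ-false {m} {n} n≤m with m <ᵇ n | <ᵇ-reflects-< m n
... | false | _        = refl
... | true  | ofʸ m<n = contradiction n≤m (<⇒≱ m<n)

<-⊔⇔ : ∀ {m a b} → m < a ⊔ b ⇔ (m < a ⊎ m < b)
<-⊔⇔ {m} {a} {b} = mk⇔ to [ m<n⇒m<n⊔o b , m<n⇒m<o⊔n a ]′
  where
  to : m < a ⊔ b → m < a ⊎ m < b
  to m<a⊔b with ⊔-sel a b
  ... | inj₁ a⊔b≡a = inj₁ (subst (m <_) a⊔b≡a m<a⊔b)
  ... | inj₂ a⊔b≡b = inj₂ (subst (m <_) a⊔b≡b m<a⊔b)

<-if⇔ : ∀ {m n} c → suc m < (if c then suc n else 0) ⇔ (T c × m < n)
<-if⇔ true  = mk⇔ (λ m+1<n+1 → tt , s≤s⁻¹ m+1<n+1) (λ (_ , m<n) → s≤s m<n)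
<-if⇔ false = mk⇔ (λ ()) (λ ())

∃-Fin-suc⇔ : ∀ {n} {P : Fin (suc n) → Set} → (∃ λ k → P k) ⇔ (P zero ⊎ ∃ λ k → P (suc k))
∃-Fin-suc⇔ = mk⇔ (λ { (zero , p) → inj₁ p ; (suc k , p) → inj₂ (k , p) })
                 [ (λ p → zero , p) , (λ (k , p) → suc k , p) ]′

length-filter-mono : ∀ {A : Set} {P Q : A → Set} (P? : Decidable P) (Q? : Decidable Q) →
                     P ⊆ Q → ∀ xs → length (filter P? xs) ≤ length (filter Q? xs)
length-filter-mono P? Q? P⊆Q xs = length-mono-≤ (filter⁺ P? Q? (λ { refl → P⊆Q }) (⊆-refl {x = xs}))

length-filter-< : ∀ {A : Set} {P Q : A → Set} (P? : Decidable P) (Q? : Decidable Q) →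
                  P ⊆ Q → ∀ {x xs} → x ∈ xs → Q x → ¬ P x →
                  length (filter P? xs) < length (filter Q? xs)
length-filter-< P? Q? P⊆Q {x} {_ ∷ xs} (here refl) qx ¬px with P? x | Q? x
... | yes px | _      = contradiction px ¬px
... | no _   | no ¬qx = contradiction qx ¬qx
... | no _   | yes _  = s≤s (length-filter-mono P? Q? P⊆Q xs)
length-filter-< P? Q? P⊆Q {xs = y ∷ _} (there x∈xs) qx ¬px
  with P? y | Q? y | length-filter-< P? Q? P⊆Q x∈xs qx ¬px
... | yes py | no ¬qy | _  = contradiction (P⊆Q py) ¬qy
... | yes _  | yes _  | ih = s≤s ih
... | no _   | yes _  | ih = m≤n⇒m≤1+n ih
... | no _   | no _   | ih = ih

filter-⇔ : ∀ {A : Set} {P Q : A → Set} (P? : Decidable P) (Q? : Decidable Q) →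
           (∀ x → P x ⇔ Q x) → ∀ xs → filter P? xs ≡ filter Q? xs
filter-⇔ P? Q? P⇔Q = filter-≐ P? Q? ((λ {x} → Equivalence.to (P⇔Q x)) , (λ {x} → Equivalence.from (P⇔Q x)))

filter-map : ∀ {A B : Set} {P : B → Set} (P? : Decidable P) (f : A → B) xs →
             filter P? (map f xs) ≡ map f (filter (P? ∘ f) xs)
filter-map P? f [] = refl
filter-map P? f (x ∷ xs) with does (P? (f x))
... | true  = cong (f x ∷_) (filter-map P? f xs)
... | false = filter-map P? f xs

filter-filter : ∀ {A : Set} {P Q : A → Set} (P? : Decidable P) (Q? : Decidable Q) xs →
                filter P? (filter Q? xs) ≡ filter (λ x → Q? x ×-dec P? x) xs
filter-filter P? Q? [] = refl
filter-filter P? Q? (x ∷ xs) with does (Q? x)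
... | false = filter-filter P? Q? xs
... | true with does (P? x)
...   | true  = cong (x ∷_) (filter-filter P? Q? xs)
...   | false = filter-filter P? Q? xs

filter-concatMap : ∀ {A B : Set} {P : B → Set} (P? : Decidable P) (f : A → List B) xs →
                   filter P? (concatMap f xs) ≡ concatMap (filter P? ∘ f) xs
filter-concatMap P? f [] = refl
filter-concatMap P? f (x ∷ xs) = trans (filter-++ P? (f x) (concatMap f xs)) (cong (filter P? (f x) ++_) (filter-concatMap P? f xs))

concatMap-filter : ∀ {A B : Set} {P : A → Set} (P? : Decidable P) (f : A → List B) xs →
                   concatMap f (filter P? xs) ≡ concatMap (λ x → if does (P? x) then f x else []) xs
concatMap-filter P? f [] = refl
concatMap-filter P? f (x ∷ xs) with does (P? x)
... | true  = cong (f x ++_) (concatMap-filter P? f xs)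
... | false = concatMap-filter P? f xs

allFin-suc : ∀ m → allFin (suc m) ≡ zero ∷ map suc (allFin m)
allFin-suc m = cong (zero ∷_) (sym (map-tabulate id suc))

tabulate-toℕ : ∀ {A : Set} n (f : ℕ → A) → List.tabulate {n = n} (f ∘ toℕ) ≡ applyUpTo f n
tabulate-toℕ zero    f = refl
tabulate-toℕ (suc n) f = cong (f 0 ∷_) (tabulate-toℕ n (f ∘ suc))

map-toℕ-allFin : ∀ {A : Set} n (f : ℕ → A) → map (f ∘ toℕ) (allFin n) ≡ map f (upTo n)
map-toℕ-allFin n f = trans (map-tabulate id (f ∘ toℕ)) (trans (tabulate-toℕ n f) (sym (map-applyUpTo id f n)))

applyUpTo-+ : ∀ {A : Set} (f : ℕ → A) m n → applyUpTo f (m + n) ≡ applyUpTo f m ++ applyUpTo (f ∘ (m +_)) n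
applyUpTo-+ f zero    n = refl
applyUpTo-+ f (suc m) n = cong (f 0 ∷_) (applyUpTo-+ (f ∘ suc) m n)

applyUpTo-cong : ∀ {A : Set} {f g : ℕ → A} n → (∀ {i} → i < n → f i ≡ g i) → applyUpTo f n ≡ applyUpTo g n
applyUpTo-cong zero    _   = refl
applyUpTo-cong (suc n) f≡g = cong₂ _∷_ (f≡g z<s) (applyUpTo-cong n (f≡g ∘ s<s))

concatMap-↭ : ∀ {A B : Set} (f : A → List B) {xs ys} → xs ↭ ys → concatMap f xs ↭ concatMap f ys
concatMap-↭ f ↭.refl           = ↭-refl
concatMap-↭ f (↭.prep x p)     = ++⁺ˡ (f x) (concatMap-↭ f p)
concatMap-↭ f (↭.swap x y p)   = ↭-trans (shifts (f x) (f y)) (++⁺ˡ (f y) (++⁺ˡ (f x) (concatMap-↭ f p)))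
concatMap-↭ f (↭.trans p q)    = ↭-trans (concatMap-↭ f p) (concatMap-↭ f q)

concatMap-cong-↭ : ∀ {A B : Set} {f g : A → List B} xs → (∀ {x} → x ∈ xs → f x ↭ g x) →
                   concatMap f xs ↭ concatMap g xs
concatMap-cong-↭ []       _  = ↭-refl
concatMap-cong-↭ (x ∷ xs) f↭g = ++⁺ (f↭g (here refl)) (concatMap-cong-↭ xs (f↭g ∘ there))

concatMap-swap : ∀ {A B C : Set} (f : A → B → C) xs ys →
                 concatMap (λ x → map (f x) ys) xs ↭ concatMap (λ y → map (λ x → f x y) xs) ys
concatMap-swap f []       ys = ↭-reflexive (sym (concatMap-[] ys))
  where
  concatMap-[] : ∀ ys → concatMap (λ _ → []) ys ≡ []
  concatMap-[] []       = refl
  concatMap-[] (_ ∷ ys) = concatMap-[] ys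
concatMap-swap f (x ∷ xs) ys = ↭-trans (++⁺ˡ (map (f x) ys) (concatMap-swap f xs ys)) (interleave ys)
  where
  interleave : ∀ ys → map (f x) ys ++ concatMap (λ y → map (λ x′ → f x′ y) xs) ys ↭
                      concatMap (λ y → map (λ x′ → f x′ y) (x ∷ xs)) ys
  interleave []       = ↭-refl
  interleave (y ∷ ys) = prep (f x y) (↭-trans (shifts (map (f x) ys) (map (λ x′ → f x′ y) xs)) (++⁺ˡ _ (interleave ys)))

-- Ranks: red on three-letter words

rank : ∀ {m k} → Vec (Fin m) k → ℕ → ℕ
rank {k = k} w y = length (filter (λ b → toℕ (lookup w b) ≤? y) (allFin k))

module _ {m k} (w : Vec (Fin m) k) where

  lookup-red : ∀ a → lookup (red w) a ≡ rank w (toℕ (lookup w a))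
  lookup-red a = lookup∘tabulate _ a

  rank-mono : ∀ {y y′} → y ≤ y′ → rank w y ≤ rank w y′
  rank-mono y≤y′ = length-filter-mono _ _ (λ p → ≤-trans p y≤y′) (allFin k)

  rank-mono-< : ∀ {y y′} b → y < toℕ (lookup w b) → toℕ (lookup w b) ≤ y′ → rank w y < rank w y′
  rank-mono-< b y<wb wb≤y′ =
    length-filter-< _ _ (λ p → ≤-trans p (≤-trans (<⇒≤ y<wb) wb≤y′)) (∈-allFin b) wb≤y′ (<⇒≱ y<wb)

  red-positive : ∀ a → 0 < lookup (red w) a
  red-positive a rewrite lookup-red a = filter-some _ (lose (∈-allFin a) ≤-refl)

  red-bounded : ∀ a → lookup (red w) a ≤ k
  red-bounded a rewrite lookup-red a =
    ≤-trans (length-filter _ (allFin k)) (≤-reflexive (length-tabulate (λ b → b)))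

  red-preserves-< : ∀ {a b} → lookup w a Fin.< lookup w b → lookup (red w) a < lookup (red w) b
  red-preserves-< {a} {b} wa<wb rewrite lookup-red a | lookup-red b = rank-mono-< b wa<wb ≤-refl

  red-reflects-< : ∀ {a b} → lookup (red w) a < lookup (red w) b → lookup w a Fin.< lookup w b
  red-reflects-< {a} {b} ra<rb rewrite lookup-red a | lookup-red b = ≰⇒> (λ wb≤wa → <⇒≱ ra<rb (rank-mono wb≤wa))

squeeze3 : ∀ {p q r} → 0 < p → p < q → q < r → r ≤ 3 → p ≡ 1 × q ≡ 2 × r ≡ 3
squeeze3 {p} {q} {r} 0<p p<q q<r r≤3 = p≡1 , q≡2 , r≡3
  where
  r≡3 = ≤-antisym r≤3 (≤-trans (s≤s (≤-trans (s≤s 0<p) p<q)) q<r)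
  q≡2 = ≤-antisym (s≤s⁻¹ (subst (q <_) r≡3 q<r)) (≤-trans (s≤s 0<p) p<q)
  p≡1 = ≤-antisym (s≤s⁻¹ (subst (p <_) q≡2 p<q)) 0<p

vec3-≡ : ∀ {x y z x′ y′ z′ : ℕ} → x ≡ x′ → y ≡ y′ → z ≡ z′ →
         Vec._∷_ x (y ∷ z ∷ []) ≡ x′ ∷ y′ ∷ z′ ∷ []
vec3-≡ refl refl refl = refl

module _ {m} (a b c : Fin m) where

  private
    w : Vec (Fin m) 3
    w = a ∷ b ∷ c ∷ []

    lookup-< : ∀ {v : Vec ℕ 3} → red w ≡ v → ∀ i j → lookup v i < lookup v j → lookup (red w) i < lookup (red w) j
    lookup-< refl i j vi<vj = vi<vj

  red≡123⇔ : red w ≡ 1 ∷ 2 ∷ 3 ∷ [] ⇔ (a Fin.< b × b Fin.< c)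
  red≡123⇔ = mk⇔
    (λ eq → red-reflects-< w {# 0} {# 1} (lookup-< eq (# 0) (# 1) (n<1+n 1))
          , red-reflects-< w {# 1} {# 2} (lookup-< eq (# 1) (# 2) (n<1+n 2)))
    (λ (a<b , b<c) →
       let (r₀ , r₁ , r₂) = squeeze3 (red-positive w (# 0)) (red-preserves-< w {# 0} {# 1} a<b)
                                     (red-preserves-< w {# 1} {# 2} b<c) (red-bounded w (# 2))
       in vec3-≡ r₀ r₁ r₂)

  red≡132⇔ : red w ≡ 1 ∷ 3 ∷ 2 ∷ [] ⇔ (a Fin.< c × c Fin.< b)
  red≡132⇔ = mk⇔
    (λ eq → red-reflects-< w {# 0} {# 2} (lookup-< eq (# 0) (# 2) (n<1+n 1))
          , red-reflects-< w {# 2} {# 1} (lookup-< eq (# 2) (# 1) (n<1+n 2)))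
    (λ (a<c , c<b) →
       let (r₀ , r₂ , r₁) = squeeze3 (red-positive w (# 0)) (red-preserves-< w {# 0} {# 2} a<c)
                                     (red-preserves-< w {# 2} {# 1} c<b) (red-bounded w (# 1))
       in vec3-≡ r₀ r₁ r₂)

-- Matches of a pattern marked at its first entry

T-vecEqᵇ : ∀ {k} {u v : Vec ℕ k} → T (vecEqᵇ u v) ⇔ u ≡ v
T-vecEqᵇ {u = []} {[]} = mk⇔ (λ _ → refl) (λ _ → tt)
T-vecEqᵇ {u = x ∷ u} {y ∷ v} = mk⇔
  (λ t → let (x≡y , u≡v) = Equivalence.to T-∧ t in cong₂ _∷_ (≡ᵇ⇒≡ x y x≡y) (Equivalence.to T-vecEqᵇ u≡v))
  (λ { refl → Equivalence.from T-∧ (≡⇒≡ᵇ x x refl , Equivalence.from (T-vecEqᵇ {u = u}) refl) })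

T-all² : ∀ {k} (p : Fin k → Fin k → Bool) →
         T (all (λ a → all (p a) (allFin k)) (allFin k)) ⇔ (∀ a b → T (p a b))
T-all² {k} p = mk⇔
  (λ t a b → All.lookup (all⁺ (p a) _ (All.lookup (all⁺ _ _ t) (∈-allFin a))) (∈-allFin b))
  (λ f → all⁻ (λ a → all (p a) (allFin k)) {allFin k}
                (All.tabulate (λ {a} _ → all⁻ (p a) {allFin k} (All.tabulate (λ {b} _ → f a b)))))

T-increasingᵇ : ∀ {m k} (w : Vec (Fin m) k) →
                T (increasingᵇ w) ⇔ (∀ a b → a Fin.< b → lookup w a Fin.< lookup w b)
T-increasingᵇ w = mk⇔ (λ t a b → to a b (Equivalence.to (T-all² _) t a b))
                      (λ f → Equivalence.from (T-all² _) (λ a b → from a b (f a b)))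
  where
  to : ∀ a b → T (if toℕ a <ᵇ toℕ b then toℕ (lookup w a) <ᵇ toℕ (lookup w b) else true) →
       a Fin.< b → lookup w a Fin.< lookup w b
  to a b t a<b with toℕ a <ᵇ toℕ b in eq
  ... | true  = <ᵇ⇒< _ _ t
  ... | false = contradiction (subst T eq (<⇒<ᵇ a<b)) λ ()
  from : ∀ a b → (a Fin.< b → lookup w a Fin.< lookup w b) →
         T (if toℕ a <ᵇ toℕ b then toℕ (lookup w a) <ᵇ toℕ (lookup w b) else true)
  from a b f with toℕ a <ᵇ toℕ b in eq
  ... | true  = <⇒<ᵇ (f (<ᵇ⇒< _ _ (subst T (sym eq) tt)))
  ... | false = tt

allWords-complete : ∀ {l m} (w : Vec (Fin m) l) → w ∈ allWords l m
allWords-complete [] = here refl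
allWords-complete {suc l} {m} (x ∷ w) =
  ∈-concat⁺′ (∈-map⁺ (x ∷_) (allWords-complete w)) (∈-map⁺ (λ y → map (y ∷_) (allWords l m)) (∈-allFin x))

∈-incTuples₃ : ∀ {n} {i j k : Fin n} → (i ∷ j ∷ k ∷ []) ∈ incTuples 3 n ⇔ (i Fin.< j × j Fin.< k)
∈-incTuples₃ {n} {i} {j} {k} = mk⇔
  (λ w∈ → let inc = Equivalence.to (T-increasingᵇ w) (proj₂ (∈-filter⁻ (T? ∘ increasingᵇ) {xs = allWords 3 n} w∈))
          in inc (# 0) (# 1) (n<1+n 0) , inc (# 1) (# 2) (n<1+n 1))
  (λ (i<j , j<k) → ∈-filter⁺ (T? ∘ increasingᵇ) (allWords-complete w)
                     (Equivalence.from (T-increasingᵇ w) (increasing i<j j<k)))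
  where
  w = i ∷ j ∷ k ∷ []
  increasing : i Fin.< j → j Fin.< k → ∀ a b → a Fin.< b → lookup w a Fin.< lookup w b
  increasing i<j j<k zero (suc zero) _ = i<j
  increasing i<j j<k zero (suc (suc zero)) _ = <-trans i<j j<k
  increasing i<j j<k (suc zero) (suc (suc zero)) _ = j<k
  increasing i<j j<k zero zero ()
  increasing i<j j<k (suc zero) zero ()
  increasing i<j j<k (suc zero) (suc zero) (s≤s ())
  increasing i<j j<k (suc (suc zero)) zero ()
  increasing i<j j<k (suc (suc zero)) (suc zero) (s≤s ())
  increasing i<j j<k (suc (suc zero)) (suc (suc zero)) (s≤s (s≤s ()))

Shape : Set₁
Shape = ∀ {m} → Fin m → Fin m → Fin m → Set

Is123 : Shape
Is123 a b c = a Fin.< b × b Fin.< c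

Is132 : Shape
Is132 a b c = a Fin.< c × c Fin.< b

Occurs : Shape → ∀ {m n} → Vec (Fin m) n → Fin n → Set
Occurs R v ℓ = ∃₂ λ j k → ℓ Fin.< j × j Fin.< k × R (lookup v ℓ) (lookup v j) (lookup v k)

hasMatchᵇ-first⇔ : ∀ (π : Vec ℕ 3) (R : Shape) → (∀ {m} {a b c : Fin m} → red (a ∷ b ∷ c ∷ []) ≡ π ⇔ R a b c) →
                   ∀ {n} (σ : Perm n) ℓ → T (hasMatchᵇ (pmpat π zero) σ ℓ) ⇔ Occurs R σ ℓ
hasMatchᵇ-first⇔ π R red≡π⇔R {n} σ ℓ = mk⇔ to from
  where
  p : Vec (Fin n) 3 → Bool
  p i = ⌊ lookup i zero Fin.≟ ℓ ⌋ ∧ vecEqᵇ (red (Vec.map (lookup σ) i)) π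
  to : T (hasMatchᵇ (pmpat π zero) σ ℓ) → Occurs R σ ℓ
  to t with find (any⁻ p (incTuples 3 n) t)
  ... | i ∷ j ∷ k ∷ [] , i∈ , pi with Equivalence.to T-∧ pi
  ... | i≡ℓ , red≡π with toWitness {a? = i Fin.≟ ℓ} i≡ℓ
  ... | refl = let (ℓ<j , j<k) = Equivalence.to ∈-incTuples₃ i∈
               in j , k , ℓ<j , j<k , Equivalence.to red≡π⇔R (Equivalence.to T-vecEqᵇ red≡π)
  from : Occurs R σ ℓ → T (hasMatchᵇ (pmpat π zero) σ ℓ)
  from (j , k , ℓ<j , j<k , r) =
    any⁺ p (lose (Equivalence.from ∈-incTuples₃ (ℓ<j , j<k))
                 (Equivalence.from T-∧ (fromWitness refl , Equivalence.from T-vecEqᵇ (Equivalence.from red≡π⇔R r))))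

hasMatchᵇ-1̲23⇔ : ∀ {n} (σ : Perm n) ℓ → T (hasMatchᵇ pat-1̲23 σ ℓ) ⇔ Occurs Is123 σ ℓ
hasMatchᵇ-1̲23⇔ = hasMatchᵇ-first⇔ _ Is123 (red≡123⇔ _ _ _)

hasMatchᵇ-1̲32⇔ : ∀ {n} (σ : Perm n) ℓ → T (hasMatchᵇ pat-1̲32 σ ℓ) ⇔ Occurs Is132 σ ℓ
hasMatchᵇ-1̲32⇔ = hasMatchᵇ-first⇔ _ Is132 (red≡132⇔ _ _ _)

Follows : Shape → ∀ {m n} → Fin m → Vec (Fin m) n → Set
Follows R x t = ∃₂ λ j k → j Fin.< k × R x (lookup t j) (lookup t k)

module _ (R : Shape) {m n} (x : Fin m) (t : Vec (Fin m) n) where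

  Occurs-head⇔ : Occurs R (x ∷ t) zero ⇔ Follows R x t
  Occurs-head⇔ = mk⇔ (λ { (suc j , suc k , _ , j<k , r) → j , k , s≤s⁻¹ j<k , r })
                     (λ (j , k , j<k , r) → suc j , suc k , s≤s z≤n , s≤s j<k , r)

  Occurs-tail⇔ : ∀ ℓ → Occurs R (x ∷ t) (suc ℓ) ⇔ Occurs R t ℓ
  Occurs-tail⇔ ℓ = mk⇔ (λ { (suc j , suc k , ℓ<j , j<k , r) → j , k , s≤s⁻¹ ℓ<j , s≤s⁻¹ j<k , r })
                       (λ (j , k , ℓ<j , j<k , r) → suc j , suc k , s≤s ℓ<j , s≤s j<k , r)

Occurs-map⇔ : ∀ (R : Shape) {m m′ n} (f : Fin m → Fin m′) → (∀ {a b c} → R (f a) (f b) (f c) ⇔ R a b c) →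
              ∀ (v : Vec (Fin m) n) ℓ → Occurs R (Vec.map f v) ℓ ⇔ Occurs R v ℓ
Occurs-map⇔ R f R∘f⇔R v ℓ = mk⇔
  (λ (j , k , ℓ<j , j<k , r) → j , k , ℓ<j , j<k , Equivalence.to R∘f⇔R (subst id (R-lookup-map j k) r))
  (λ (j , k , ℓ<j , j<k , r) → j , k , ℓ<j , j<k , subst id (sym (R-lookup-map j k)) (Equivalence.from R∘f⇔R r))
  where
  R-lookup-map : ∀ j k → R (lookup (Vec.map f v) ℓ) (lookup (Vec.map f v) j) (lookup (Vec.map f v) k)
                       ≡ R (f (lookup v ℓ)) (f (lookup v j)) (f (lookup v k))
  R-lookup-map j k rewrite lookup-map ℓ f v | lookup-map j f v | lookup-map k f v = refl

punchIn-<⇔ : ∀ {m} (x : Fin (suc m)) {a b : Fin m} → punchIn x a Fin.< punchIn x b ⇔ a Fin.< b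
punchIn-<⇔ x {a} {b} = mk⇔ (λ p<q → ≰⇒> (λ b≤a → <⇒≱ p<q (punchIn-mono-≤ x b a b≤a)))
                           (λ a<b → ≰⇒> (λ q≤p → <⇒≱ a<b (punchIn-cancel-≤ x b a q≤p)))

Is123-punchIn⇔ : ∀ {m} (x : Fin (suc m)) {a b c : Fin m} → Is123 (punchIn x a) (punchIn x b) (punchIn x c) ⇔ Is123 a b c
Is123-punchIn⇔ x = punchIn-<⇔ x ×-⇔ punchIn-<⇔ x

Is132-punchIn⇔ : ∀ {m} (x : Fin (suc m)) {a b c : Fin m} → Is132 (punchIn x a) (punchIn x b) (punchIn x c) ⇔ Is132 a b c
Is132-punchIn⇔ x = punchIn-<⇔ x ×-⇔ punchIn-<⇔ x

count : ∀ {n} → (Fin n → Bool) → ℕ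
count {n} f = length (filter (T? ∘ f) (allFin n))

count-tail : ∀ {n} (f : Fin (suc n) → Bool) →
             length (filter (T? ∘ f) (List.tabulate Fin.suc)) ≡ count (f ∘ Fin.suc)
count-tail {n} f = begin
  length (filter (T? ∘ f) (List.tabulate Fin.suc))            ≡⟨ cong (length ∘ filter (T? ∘ f)) (map-tabulate id Fin.suc) ⟨
  length (filter (T? ∘ f) (map Fin.suc (allFin n)))           ≡⟨ cong length (filter-map (T? ∘ f) Fin.suc (allFin n)) ⟩
  length (map Fin.suc (filter (T? ∘ f ∘ Fin.suc) (allFin n))) ≡⟨ length-map Fin.suc (filter (T? ∘ f ∘ Fin.suc) (allFin n)) ⟩
  count (f ∘ Fin.suc)                                          ∎
  where open ≡-Reasoning

count-suc : ∀ {n} (f : Fin (suc n) → Bool) →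
            count f ≡ (if f zero then suc (count (f ∘ suc)) else count (f ∘ suc))
count-suc f with f zero
... | true  = cong suc (count-tail f)
... | false = count-tail f

count-cong : ∀ {n} {f g : Fin n → Bool} → (∀ i → T (f i) ⇔ T (g i)) → count f ≡ count g
count-cong {n} f⇔g = cong length (filter-⇔ _ _ f⇔g (allFin n))

-- Permutations of [n+1] as a first letter followed by a relabelled permutation of [n]

wordsOver : ∀ {A : Set} → List A → (l : ℕ) → List (Vec A l)
wordsOver as zero    = [ [] ]
wordsOver as (suc l) = concatMap (λ a → map (a ∷_) (wordsOver as l)) as

allWords≡wordsOver : ∀ l m → allWords l m ≡ wordsOver (allFin m) l
allWords≡wordsOver zero    m = refl
allWords≡wordsOver (suc l) m = cong (λ ws → concatMap (λ a → map (a ∷_) ws) (allFin m)) (allWords≡wordsOver l m)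

wordsOver-map : ∀ {A B : Set} (f : A → B) as l → wordsOver (map f as) l ≡ map (Vec.map f) (wordsOver as l)
wordsOver-map f as zero    = refl
wordsOver-map f as (suc l) = begin
  concatMap (λ b → map (b ∷_) (wordsOver (map f as) l)) (map f as)   ≡⟨ concatMap-map _ f as ⟩
  concatMap (λ a → map (f a ∷_) (wordsOver (map f as) l)) as         ≡⟨ concatMap-cong step as ⟩
  concatMap (λ a → map (Vec.map f) (map (a ∷_) (wordsOver as l))) as ≡⟨ map-concatMap (Vec.map f) _ as ⟨
  map (Vec.map f) (wordsOver as (suc l))                              ∎
  where
  open ≡-Reasoning
  step : ∀ a → map (f a ∷_) (wordsOver (map f as) l) ≡ map (Vec.map f) (map (a ∷_) (wordsOver as l))
  step a = trans (cong (map (f a ∷_)) (wordsOver-map f as l)) (trans (sym (map-∘ (wordsOver as l))) (map-∘ (wordsOver as l)))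

filter-wordsOver : ∀ {A : Set} {P : A → Set} (P? : Decidable P) as l →
                   filter (VecAll.all? P?) (wordsOver as l) ≡ wordsOver (filter P? as) l
filter-wordsOver P? as zero    = refl
filter-wordsOver {A} {P} P? as (suc l) = begin
  filter All? (concatMap (λ a → map (a ∷_) W) as)
    ≡⟨ filter-concatMap All? _ as ⟩
  concatMap (λ a → filter All? (map (a ∷_) W)) as
    ≡⟨ concatMap-cong (λ a → filter-map All? (a ∷_) W) as ⟩
  concatMap (λ a → map (a ∷_) (filter (All? ∘ (a ∷_)) W)) as
    ≡⟨ concatMap-cong step as ⟩
  concatMap (λ a → if does (P? a) then map (a ∷_) (filter All? W) else []) as
    ≡⟨ concatMap-filter P? _ as ⟨
  concatMap (λ a → map (a ∷_) (filter All? W)) (filter P? as)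
    ≡⟨ cong (λ ws → concatMap (λ a → map (a ∷_) ws) (filter P? as)) (filter-wordsOver P? as l) ⟩
  wordsOver (filter P? as) (suc l) ∎
  where
  open ≡-Reasoning
  W = wordsOver as l
  All? : ∀ {k} (w : Vec A k) → Dec (VecAll.All P w)
  All? = VecAll.all? P?
  step : ∀ a → map (a ∷_) (filter (All? ∘ (a ∷_)) W) ≡ (if does (P? a) then map (a ∷_) (filter All? W) else [])
  step a with P? a
  ... | yes pa = cong (map (a ∷_)) (filter-≐ _ _ ((λ { (_ VecAll.∷ pw) → pw }) , (pa VecAll.∷_)) W)
  ... | no ¬pa = cong (map (a ∷_)) (filter-none _ {W} (All.tabulate (λ _ → λ { (pa VecAll.∷ _) → ¬pa pa })))

filter-allFin-≢ : ∀ {m} (x : Fin (suc m)) → filter (λ y → ¬? (y Fin.≟ x)) (allFin (suc m)) ≡ map (punchIn x) (allFin m)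
filter-allFin-≢ {m} zero = begin
  filter ≢0? (allFin (suc m))            ≡⟨ cong (filter ≢0?) (allFin-suc m) ⟩
  filter ≢0? (zero ∷ map suc (allFin m)) ≡⟨ filter-reject ≢0? {xs = map suc (allFin m)} (λ z≢z → z≢z refl) ⟩
  filter ≢0? (map suc (allFin m))        ≡⟨ filter-map ≢0? suc (allFin m) ⟩
  map suc (filter (≢0? ∘ suc) (allFin m)) ≡⟨ cong (map suc) (filter-all (≢0? ∘ suc) (All.tabulate (λ _ ()))) ⟩
  map suc (allFin m)                     ∎
  where
  open ≡-Reasoning
  ≢0? = λ (y : Fin (suc m)) → ¬? (y Fin.≟ zero)
filter-allFin-≢ {suc m} (suc x) = begin
  filter ≢x+1? (allFin (suc (suc m)))                       ≡⟨ cong (filter ≢x+1?) (allFin-suc (suc m)) ⟩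
  filter ≢x+1? (zero ∷ map suc (allFin (suc m)))            ≡⟨ filter-accept ≢x+1? {xs = map suc (allFin (suc m))} (λ ()) ⟩
  zero ∷ filter ≢x+1? (map suc (allFin (suc m)))            ≡⟨ cong (zero ∷_) (filter-map ≢x+1? suc (allFin (suc m))) ⟩
  zero ∷ map suc (filter (≢x+1? ∘ suc) (allFin (suc m)))
    ≡⟨ cong (λ ys → zero ∷ map suc ys) (filter-⇔ (≢x+1? ∘ suc) ≢x? suc≢⇔ (allFin (suc m))) ⟩
  zero ∷ map suc (filter ≢x? (allFin (suc m)))              ≡⟨ cong (λ ys → zero ∷ map suc ys) (filter-allFin-≢ x) ⟩
  zero ∷ map suc (map (punchIn x) (allFin m))               ≡⟨ cong (zero ∷_) (map-∘ (allFin m)) ⟨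
  zero ∷ map (punchIn (suc x) ∘ suc) (allFin m)             ≡⟨ cong (zero ∷_) (map-∘ (allFin m)) ⟩
  map (punchIn (suc x)) (zero ∷ map suc (allFin m))         ≡⟨ cong (map (punchIn (suc x))) (allFin-suc m) ⟨
  map (punchIn (suc x)) (allFin (suc m))                    ∎
  where
  open ≡-Reasoning
  ≢x+1? = λ (y : Fin (suc (suc m))) → ¬? (y Fin.≟ suc x)
  ≢x? = λ (y : Fin (suc m)) → ¬? (y Fin.≟ x)
  suc≢⇔ = λ (y : Fin (suc m)) → mk⇔ (λ y+1≢x+1 → y+1≢x+1 ∘ cong suc) (λ y≢x → y≢x ∘ suc-injective)

T-distinctᵇ : ∀ {m k} (w : Vec (Fin m) k) → T (distinctᵇ w) ⇔ Injective _≡_ _≡_ (lookup w)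
T-distinctᵇ w = mk⇔ (λ t {a} {b} → to a b (Equivalence.to (T-all² _) t a b))
                    (λ inj → Equivalence.from (T-all² _) (λ a b → from a b inj))
  where
  to : ∀ a b → T (if ⌊ a Fin.≟ b ⌋ then true else (if ⌊ lookup w a Fin.≟ lookup w b ⌋ then false else true)) →
       lookup w a ≡ lookup w b → a ≡ b
  to a b t wa≡wb with a Fin.≟ b
  ... | yes a≡b = a≡b
  ... | no _ with lookup w a Fin.≟ lookup w b
  ...   | no wa≢wb = contradiction wa≡wb wa≢wb
  from : ∀ a b → Injective _≡_ _≡_ (lookup w) →
         T (if ⌊ a Fin.≟ b ⌋ then true else (if ⌊ lookup w a Fin.≟ lookup w b ⌋ then false else true))
  from a b inj with a Fin.≟ b
  ... | yes _ = tt
  ... | no a≢b with lookup w a Fin.≟ lookup w b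
  ...   | yes wa≡wb = contradiction (inj wa≡wb) a≢b
  ...   | no _      = tt

Injective-∷⇔ : ∀ {m k} (x : Fin m) (w : Vec (Fin m) k) →
               Injective _≡_ _≡_ (lookup (x ∷ w)) ⇔ (VecAll.All (_≢ x) w × Injective _≡_ _≡_ (lookup w))
Injective-∷⇔ x w = mk⇔ (λ inj → lookup⁻ (λ i wi≡x → contradiction (inj {suc i} {zero} wi≡x) λ ())
                              , λ {a} {b} wa≡wb → suc-injective (inj {suc a} {suc b} wa≡wb))
                       from
  where
  from : VecAll.All (_≢ x) w × Injective _≡_ _≡_ (lookup w) → Injective _≡_ _≡_ (lookup (x ∷ w))
  from _            {zero}  {zero}  _ = refl
  from (x∉w , _)    {zero}  {suc b} x≡wb = contradiction (sym x≡wb) (lookup⁺ x∉w b)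
  from (x∉w , _)    {suc a} {zero}  wa≡x = contradiction wa≡x (lookup⁺ x∉w a)
  from (_ , inj)    {suc a} {suc b} wa≡wb = cong suc (inj wa≡wb)

Injective-map⇔ : ∀ {m m′ k} {f : Fin m → Fin m′} → Injective _≡_ _≡_ f → (w : Vec (Fin m) k) →
                 Injective _≡_ _≡_ (lookup (Vec.map f w)) ⇔ Injective _≡_ _≡_ (lookup w)
Injective-map⇔ {f = f} f-inj w = mk⇔
  (λ inj {a} {b} wa≡wb → inj (trans (lookup-map a f w) (trans (cong f wa≡wb) (sym (lookup-map b f w)))))
  (λ inj {a} {b} fwa≡fwb → inj (f-inj (trans (sym (lookup-map a f w)) (trans fwa≡fwb (lookup-map b f w)))))

prepend : ∀ {n} → Fin (suc n) → Perm n → Perm (suc n)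
prepend x ρ = x ∷ Vec.map (punchIn x) ρ

words-avoiding : ∀ {l m} (x : Fin (suc m)) →
                 filter (VecAll.all? (λ y → ¬? (y Fin.≟ x))) (allWords l (suc m)) ≡ map (Vec.map (punchIn x)) (allWords l m)
words-avoiding {l} {m} x = begin
  filter (VecAll.all? ≢x?) (allWords l (suc m))              ≡⟨ cong (filter (VecAll.all? ≢x?)) (allWords≡wordsOver l (suc m)) ⟩
  filter (VecAll.all? ≢x?) (wordsOver (allFin (suc m)) l)    ≡⟨ filter-wordsOver ≢x? (allFin (suc m)) l ⟩
  wordsOver (filter ≢x? (allFin (suc m))) l                  ≡⟨ cong (λ as → wordsOver as l) (filter-allFin-≢ x) ⟩
  wordsOver (map (punchIn x) (allFin m)) l                   ≡⟨ wordsOver-map (punchIn x) (allFin m) l ⟩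
  map (Vec.map (punchIn x)) (wordsOver (allFin m) l)         ≡⟨ cong (map (Vec.map (punchIn x))) (allWords≡wordsOver l m) ⟨
  map (Vec.map (punchIn x)) (allWords l m)                   ∎
  where
  open ≡-Reasoning
  ≢x? = λ (y : Fin (suc m)) → ¬? (y Fin.≟ x)

injective-extensions : ∀ {n} (x : Fin (suc n)) →
                       filter (λ w → T? (distinctᵇ (x ∷ w))) (allWords n (suc n)) ≡ map (Vec.map (punchIn x)) (S n)
injective-extensions {n} x = begin
  filter (λ w → Inj? (x ∷ w)) (allWords n (suc n))
    ≡⟨ filter-⇔ _ _ ∷⇔ (allWords n (suc n)) ⟩
  filter (λ w → VecAll.all? ≢x? w ×-dec Inj? w) (allWords n (suc n))
    ≡⟨ filter-filter Inj? (VecAll.all? ≢x?) (allWords n (suc n)) ⟨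
  filter Inj? (filter (VecAll.all? ≢x?) (allWords n (suc n)))
    ≡⟨ cong (filter Inj?) (words-avoiding x) ⟩
  filter Inj? (map (Vec.map (punchIn x)) (allWords n n))
    ≡⟨ filter-map Inj? (Vec.map (punchIn x)) (allWords n n) ⟩
  map (Vec.map (punchIn x)) (filter (Inj? ∘ Vec.map (punchIn x)) (allWords n n))
    ≡⟨ cong (map (Vec.map (punchIn x))) (filter-⇔ _ _ map⇔ (allWords n n)) ⟩
  map (Vec.map (punchIn x)) (S n) ∎
  where
  open ≡-Reasoning
  Inj? : ∀ {m k} (w : Vec (Fin m) k) → Dec (T (distinctᵇ w))
  Inj? w = T? (distinctᵇ w)
  ≢x? = λ (y : Fin (suc n)) → ¬? (y Fin.≟ x)
  ∷⇔ : ∀ w → T (distinctᵇ (x ∷ w)) ⇔ (VecAll.All (_≢ x) w × T (distinctᵇ w))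
  ∷⇔ w = ⇔-trans (T-distinctᵇ (x ∷ w)) (⇔-trans (Injective-∷⇔ x w) (⇔-refl ×-⇔ ⇔-sym (T-distinctᵇ w)))
  map⇔ : ∀ w → T (distinctᵇ (Vec.map (punchIn x) w)) ⇔ T (distinctᵇ w)
  map⇔ w = ⇔-trans (T-distinctᵇ (Vec.map (punchIn x) w))
                   (⇔-trans (Injective-map⇔ (punchIn-injective x _ _) w) (⇔-sym (T-distinctᵇ w)))

S-suc : ∀ n → S (suc n) ≡ concatMap (λ x → map (prepend x) (S n)) (allFin (suc n))
S-suc n = begin
  filter Inj? (concatMap (λ x → map (x ∷_) W) (allFin (suc n)))
    ≡⟨ filter-concatMap Inj? (λ x → map (x ∷_) W) (allFin (suc n)) ⟩
  concatMap (λ x → filter Inj? (map (x ∷_) W)) (allFin (suc n))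
    ≡⟨ concatMap-cong (λ x → filter-map Inj? (x ∷_) W) (allFin (suc n)) ⟩
  concatMap (λ x → map (x ∷_) (filter (Inj? ∘ (x ∷_)) W)) (allFin (suc n))
    ≡⟨ concatMap-cong (λ x → trans (cong (map (x ∷_)) (injective-extensions x)) (sym (map-∘ (S n)))) (allFin (suc n)) ⟩
  concatMap (λ x → map (prepend x) (S n)) (allFin (suc n)) ∎
  where
  open ≡-Reasoning
  Inj? : ∀ {k} (w : Vec (Fin (suc n)) k) → Dec (T (distinctᵇ w))
  Inj? w = T? (distinctᵇ w)
  W = allWords n (suc n)

∈-S-suc⁻ : ∀ {n} {σ : Perm (suc n)} → σ ∈ S (suc n) → ∃₂ λ x ρ → ρ ∈ S n × σ ≡ prepend x ρ
∈-S-suc⁻ {n} σ∈ with find (∈-concatMap⁻ (λ x → map (prepend x) (S n)) {xs = allFin (suc n)} (subst (_ ∈_) (S-suc n) σ∈))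
... | x , _ , σ∈x⊕S with ∈-map⁻ (prepend x) σ∈x⊕S
...   | ρ , ρ∈ , σ≡x⊕ρ = x , ρ , ρ∈ , σ≡x⊕ρ

Onto : ∀ {m n} → Vec (Fin m) n → Set
Onto t = ∀ y → ∃ λ k → lookup t k ≡ y

punchIn-tail-hits : ∀ {n} (x : Fin (suc n)) {ρ : Vec (Fin n) n} → Onto ρ →
                    ∀ {y} → x ≢ y → ∃ λ k → lookup (Vec.map (punchIn x) ρ) k ≡ y
punchIn-tail-hits x {ρ} ρ-onto x≢y = let (k , ρk≡) = ρ-onto (punchOut x≢y) in
  k , trans (lookup-map k (punchIn x) ρ) (trans (cong (punchIn x) ρk≡) (punchIn-punchOut x≢y))

S-surjective : ∀ {n} {ρ : Perm n} → ρ ∈ S n → Onto ρ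
S-surjective {suc n} σ∈ y with ∈-S-suc⁻ σ∈
... | x , ρ , ρ∈ , refl with x Fin.≟ y
...   | yes refl = zero , refl
...   | no x≢y   = let (k , hit) = punchIn-tail-hits x {ρ} (S-surjective ρ∈) x≢y in suc k , hit

-- Thresholds are stored as 1 + letter, with 0 meaning "no such letter"; raise a is the effect on
-- such a value of inserting a new letter a (see suc-toℕ-punchIn).
raise : ℕ → ℕ → ℕ
raise a b = if b ≤ᵇ a then b else suc b

raise-suc : ∀ a b → suc (raise a (suc b)) ≡ raise (suc a) (suc (suc b))
raise-suc a b with b <ᵇ a
... | true  = refl
... | false = refl

suc-toℕ-punchIn : ∀ {m} (x : Fin (suc m)) y → suc (toℕ (punchIn x y)) ≡ raise (toℕ x) (suc (toℕ y))
suc-toℕ-punchIn zero    y       = refl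
suc-toℕ-punchIn (suc x) zero    = refl
suc-toℕ-punchIn (suc x) (suc y) = trans (cong suc (suc-toℕ-punchIn x y)) (raise-suc (toℕ x) (toℕ y))

raise-mono : ∀ a {b c} → b ≤ c → raise a b ≤ raise a c
raise-mono a {b} {c} b≤c with b ≤ᵇ a | ≤ᵇ-reflects-≤ b a | c ≤ᵇ a | ≤ᵇ-reflects-≤ c a
... | true  | _        | true  | _        = b≤c
... | true  | _        | false | _        = m≤n⇒m≤1+n b≤c
... | false | ofⁿ b≰a | true  | ofʸ c≤a = contradiction (≤-trans b≤c c≤a) b≰a
... | false | _        | false | _        = s≤s b≤c

raise-⊔ : ∀ a b c → raise a (b ⊔ c) ≡ raise a b ⊔ raise a c
raise-⊔ a = mono-≤-distrib-⊔ (raise-mono a)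

raise-if : ∀ a c v → raise a (if c then v else 0) ≡ (if c then raise a v else 0)
raise-if a true  v = refl
raise-if a false v = refl

punchIn-<ᵇ : ∀ {m} (x : Fin (suc m)) a b → (toℕ (punchIn x a) <ᵇ toℕ (punchIn x b)) ≡ (toℕ a <ᵇ toℕ b)
punchIn-<ᵇ x a b = T-injective (⇔-trans T-<ᵇ (⇔-trans (punchIn-<⇔ x) (⇔-sym T-<ᵇ)))

sucMax : ∀ {m n} → (Fin m → Bool) → Vec (Fin m) n → ℕ
sucMax p []      = 0
sucMax p (z ∷ t) = (if p z then suc (toℕ z) else 0) ⊔ sucMax p t

sucMax-<⇔ : ∀ {m n} (p : Fin m → Bool) {y} (t : Vec (Fin m) n) →
            suc y < sucMax p t ⇔ (∃ λ k → T (p (lookup t k)) × y < toℕ (lookup t k))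
sucMax-<⇔ p []      = mk⇔ (λ ()) (λ { (() , _) })
sucMax-<⇔ p (z ∷ t) = ⇔-trans <-⊔⇔ (⇔-trans (<-if⇔ (p z) ⊎-⇔ sucMax-<⇔ p t) (⇔-sym ∃-Fin-suc⇔))

sucMax-≤ : ∀ {m n} (p : Fin m → Bool) {c} (t : Vec (Fin m) n) →
           (∀ k → T (p (lookup t k)) → toℕ (lookup t k) < c) → sucMax p t ≤ c
sucMax-≤ p []      _     = z≤n
sucMax-≤ p (z ∷ t) bound = ⊔-lub head (sucMax-≤ p t (bound ∘ suc))
  where
  head : (if p z then suc (toℕ z) else 0) ≤ _
  head with p z | bound zero
  ... | true  | z<c = z<c tt
  ... | false | _   = z≤n

sucMax-≥ : ∀ {m n} (p : Fin m → Bool) (t : Vec (Fin m) n) {k y} → lookup t k ≡ y → T (p y) → suc (toℕ y) ≤ sucMax p t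
sucMax-≥ p (z ∷ t) {zero}  refl pz rewrite Equivalence.to T-≡ pz = m≤m⊔n (suc (toℕ z)) (sucMax p t)
sucMax-≥ p (z ∷ t) {suc k} tk≡y py = ≤-trans (sucMax-≥ p t tk≡y py) (m≤n⊔m _ (sucMax p t))

sucMax-punchIn : ∀ {m n} (x : Fin (suc m)) {p q} → (∀ z → p (punchIn x z) ≡ q z) →
                 (t : Vec (Fin m) n) → sucMax p (Vec.map (punchIn x) t) ≡ raise (toℕ x) (sucMax q t)
sucMax-punchIn x p≡q []      = refl
sucMax-punchIn x {p} {q} p≡q (z ∷ t) = begin
  (if p (punchIn x z) then suc (toℕ (punchIn x z)) else 0) ⊔ sucMax p (Vec.map (punchIn x) t)
    ≡⟨ cong₂ (λ c v → (if c then v else 0) ⊔ _) (p≡q z) (suc-toℕ-punchIn x z) ⟩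
  (if q z then raise (toℕ x) (suc (toℕ z)) else 0) ⊔ sucMax p (Vec.map (punchIn x) t)
    ≡⟨ cong₂ _⊔_ (sym (raise-if (toℕ x) (q z) _)) (sucMax-punchIn x p≡q t) ⟩
  raise (toℕ x) (if q z then suc (toℕ z) else 0) ⊔ raise (toℕ x) (sucMax q t)
    ≡⟨ raise-⊔ (toℕ x) (if q z then suc (toℕ z) else 0) (sucMax q t) ⟨
  raise (toℕ x) (sucMax q (z ∷ t)) ∎
  where open ≡-Reasoning

hasLarger : ∀ {m n} → Fin m → Vec (Fin m) n → Bool
hasLarger y []      = false
hasLarger y (z ∷ t) = (toℕ y <ᵇ toℕ z) ∨ hasLarger y t

T-hasLarger : ∀ {m n} (y : Fin m) (t : Vec (Fin m) n) → T (hasLarger y t) ⇔ (∃ λ k → y Fin.< lookup t k)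
T-hasLarger y []      = mk⇔ (λ ()) (λ { (() , _) })
T-hasLarger y (z ∷ t) = ⇔-trans T-∨ (⇔-trans (T-<ᵇ ⊎-⇔ T-hasLarger y t) (⇔-sym ∃-Fin-suc⇔))

hasLarger-punchIn : ∀ {m n} (x : Fin (suc m)) y (t : Vec (Fin m) n) →
                    hasLarger (punchIn x y) (Vec.map (punchIn x) t) ≡ hasLarger y t
hasLarger-punchIn x y []      = refl
hasLarger-punchIn x y (z ∷ t) = cong₂ _∨_ (punchIn-<ᵇ x y z) (hasLarger-punchIn x y t)

Follows-∷⇔ : ∀ (R : Shape) {m n} (x y : Fin m) (t : Vec (Fin m) n) →
             Follows R x (y ∷ t) ⇔ ((∃ λ k → R x y (lookup t k)) ⊎ Follows R x t)
Follows-∷⇔ R x y t = mk⇔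
  (λ { (zero , suc k , _ , r) → inj₁ (k , r) ; (suc j , suc k , j<k , r) → inj₂ (j , k , s≤s⁻¹ j<k , r) })
  [ (λ (k , r) → zero , suc k , s≤s z≤n , r) , (λ (j , k , j<k , r) → suc j , suc k , s≤s j<k , r) ]′

-- 1 + the largest letter of t followed (bound123), resp. preceded (bound132), in t by a larger
-- letter, or 0 if there is none.
bound123 : ∀ {m n} → Vec (Fin m) n → ℕ
bound123 []      = 0
bound123 (y ∷ t) = (if hasLarger y t then suc (toℕ y) else 0) ⊔ bound123 t

bound132 : ∀ {m n} → Vec (Fin m) n → ℕ
bound132 []      = 0
bound132 (y ∷ t) = sucMax (λ z → toℕ z <ᵇ toℕ y) t ⊔ bound132 t

Follows-123⇔ : ∀ {m n} (x : Fin m) (t : Vec (Fin m) n) → Follows Is123 x t ⇔ suc (toℕ x) < bound123 t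
Follows-123⇔ x []      = mk⇔ (λ { (() , _) }) (λ ())
Follows-123⇔ x (y ∷ t) = ⇔-trans (Follows-∷⇔ Is123 x y t) (⇔-trans (head ⊎-⇔ Follows-123⇔ x t) (⇔-sym <-⊔⇔))
  where
  head : (∃ λ k → x Fin.< y × y Fin.< lookup t k) ⇔ suc (toℕ x) < (if hasLarger y t then suc (toℕ y) else 0)
  head = ⇔-trans (mk⇔ (λ (k , x<y , y<tk) → Equivalence.from (T-hasLarger y t) (k , y<tk) , x<y)
                      (λ (h , x<y) → let (k , y<tk) = Equivalence.to (T-hasLarger y t) h in k , x<y , y<tk))
                 (⇔-sym (<-if⇔ (hasLarger y t)))

Follows-132⇔ : ∀ {m n} (x : Fin m) (t : Vec (Fin m) n) → Follows Is132 x t ⇔ suc (toℕ x) < bound132 t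
Follows-132⇔ x []      = mk⇔ (λ { (() , _) }) (λ ())
Follows-132⇔ x (y ∷ t) = ⇔-trans (Follows-∷⇔ Is132 x y t) (⇔-trans (head ⊎-⇔ Follows-132⇔ x t) (⇔-sym <-⊔⇔))
  where
  head : (∃ λ k → x Fin.< lookup t k × lookup t k Fin.< y) ⇔ suc (toℕ x) < sucMax (λ z → toℕ z <ᵇ toℕ y) t
  head = ⇔-trans (mk⇔ (λ (k , x<tk , tk<y) → k , <⇒<ᵇ tk<y , x<tk) (λ (k , tk<y , x<tk) → k , x<tk , <ᵇ⇒< _ _ tk<y))
                 (⇔-sym (sucMax-<⇔ _ t))

bound123-punchIn : ∀ {m n} (x : Fin (suc m)) (t : Vec (Fin m) n) →
                   bound123 (Vec.map (punchIn x) t) ≡ raise (toℕ x) (bound123 t)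
bound123-punchIn x []      = refl
bound123-punchIn x (y ∷ t) = begin
  (if hasLarger (punchIn x y) (Vec.map (punchIn x) t) then suc (toℕ (punchIn x y)) else 0) ⊔ bound123 (Vec.map (punchIn x) t)
    ≡⟨ cong₂ (λ c v → (if c then v else 0) ⊔ _) (hasLarger-punchIn x y t) (suc-toℕ-punchIn x y) ⟩
  (if hasLarger y t then raise (toℕ x) (suc (toℕ y)) else 0) ⊔ bound123 (Vec.map (punchIn x) t)
    ≡⟨ cong₂ _⊔_ (sym (raise-if (toℕ x) (hasLarger y t) _)) (bound123-punchIn x t) ⟩
  raise (toℕ x) (if hasLarger y t then suc (toℕ y) else 0) ⊔ raise (toℕ x) (bound123 t)
    ≡⟨ raise-⊔ (toℕ x) (if hasLarger y t then suc (toℕ y) else 0) (bound123 t) ⟨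
  raise (toℕ x) (bound123 (y ∷ t)) ∎
  where open ≡-Reasoning

bound132-punchIn : ∀ {m n} (x : Fin (suc m)) (t : Vec (Fin m) n) →
                   bound132 (Vec.map (punchIn x) t) ≡ raise (toℕ x) (bound132 t)
bound132-punchIn x []      = refl
bound132-punchIn x (y ∷ t) = begin
  sucMax (λ z → toℕ z <ᵇ toℕ (punchIn x y)) (Vec.map (punchIn x) t) ⊔ bound132 (Vec.map (punchIn x) t)
    ≡⟨ cong₂ _⊔_ (sucMax-punchIn x (λ z → punchIn-<ᵇ x z y) t) (bound132-punchIn x t) ⟩
  raise (toℕ x) (sucMax (λ z → toℕ z <ᵇ toℕ y) t) ⊔ raise (toℕ x) (bound132 t)
    ≡⟨ raise-⊔ (toℕ x) (sucMax (λ z → toℕ z <ᵇ toℕ y) t) (bound132 t) ⟨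
  raise (toℕ x) (bound132 (y ∷ t)) ∎
  where open ≡-Reasoning

bound132-≤ : ∀ {m n} (t : Vec (Fin m) n) → bound132 t ≤ m
bound132-≤ []      = z≤n
bound132-≤ (y ∷ t) = ⊔-lub (sucMax-≤ _ t (λ k _ → toℕ<n (lookup t k))) (bound132-≤ t)

hasLarger-prepend : ∀ {n} (x : Fin (suc n)) {ρ : Perm n} → Onto ρ → hasLarger x (Vec.map (punchIn x) ρ) ≡ (toℕ x <ᵇ n)
hasLarger-prepend {n} x {ρ} ρ-onto =
  T-injective (⇔-trans (T-hasLarger x t) (⇔-trans (mk⇔ to from) (⇔-sym T-<ᵇ)))
  where
  t = Vec.map (punchIn x) ρ
  to : (∃ λ k → x Fin.< lookup t k) → toℕ x < n
  to (k , x<tk) = <-≤-trans x<tk (s≤s⁻¹ (toℕ<n (lookup t k)))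
  from : toℕ x < n → ∃ λ k → x Fin.< lookup t k
  from x<n = let (k , tk≡n) = punchIn-tail-hits x {ρ} ρ-onto x≢n
             in k , subst (x Fin.<_) (sym tk≡n) (subst (toℕ x <_) (sym (toℕ-fromℕ n)) x<n)
    where
    x≢n : x ≢ fromℕ n
    x≢n x≡n = <-irrefl (trans (cong toℕ x≡n) (toℕ-fromℕ n)) x<n

sucMax-below-prepend-≥ : ∀ {n} (x : Fin (suc n)) {ρ : Perm n} → Onto ρ →
                         toℕ x ≤ sucMax (λ z → toℕ z <ᵇ toℕ x) (Vec.map (punchIn x) ρ)
sucMax-below-prepend-≥ zero     _ = z≤n
sucMax-below-prepend-≥ (suc x) {ρ} ρ-onto =
  subst (_≤ sucMax p t) (cong suc (toℕ-inject₁ x)) (sucMax-≥ p t tk≡x (<⇒<ᵇ x<x+1))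
  where
  p = λ (z : Fin (suc _)) → toℕ z <ᵇ suc (toℕ x)
  t = Vec.map (punchIn (suc x)) ρ
  x<x+1 : toℕ (inject₁ x) < suc (toℕ x)
  x<x+1 = subst (_< suc (toℕ x)) (sym (toℕ-inject₁ x)) ≤-refl
  x+1≢x : suc x ≢ inject₁ x
  x+1≢x x+1≡x = <-irrefl (sym (trans (cong toℕ x+1≡x) (toℕ-inject₁ x))) (n<1+n (toℕ x))
  k = proj₁ (punchIn-tail-hits (suc x) {ρ} ρ-onto x+1≢x)
  tk≡x = proj₂ (punchIn-tail-hits (suc x) {ρ} ρ-onto x+1≢x)

sucMax-below-prepend : ∀ {n} (x : Fin (suc n)) {ρ : Perm n} → Onto ρ →
                       sucMax (λ z → toℕ z <ᵇ toℕ x) (Vec.map (punchIn x) ρ) ≡ toℕ x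
sucMax-below-prepend x {ρ} ρ-onto =
  ≤-antisym (sucMax-≤ _ (Vec.map (punchIn x) ρ) (λ k → <ᵇ⇒< _ _)) (sucMax-below-prepend-≥ x {ρ} ρ-onto)

-- Transitions of the pair (threshold, pmp)

raise-cases : ∀ a b → (b ≤ a × raise a b ≡ b × (a <ᵇ b) ≡ false) ⊎ (a < b × raise a b ≡ suc b × (a <ᵇ b) ≡ true)
raise-cases a b with b ≤ᵇ a | ≤ᵇ-reflects-≤ b a | a <ᵇ b | <ᵇ-reflects-< a b
... | true  | ofʸ b≤a | false | _        = inj₁ (b≤a , refl , refl)
... | true  | ofʸ b≤a | true  | ofʸ a<b = contradiction b≤a (<⇒≱ a<b)
... | false | _        | true  | ofʸ a<b = inj₂ (a<b , refl , refl)
... | false | ofⁿ b≰a | false | ofⁿ a≮b = contradiction (≰⇒> b≰a) a≮b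

suc-<-raise⇔ : ∀ a b → suc a < raise a b ⇔ a < b
suc-<-raise⇔ a b with raise-cases a b
... | inj₁ (b≤a , r≡b , _) rewrite r≡b = mk⇔ (λ a+1<b → contradiction (≤-trans (<⇒≤ a+1<b) b≤a) (<⇒≱ (n<1+n a)))
                                             (λ a<b → contradiction b≤a (<⇒≱ a<b))
... | inj₂ (_ , r≡b+1 , _) rewrite r≡b+1 = mk⇔ s≤s⁻¹ s≤s

if-⊔-raise : ∀ c a b → (if c then suc a else 0) ⊔ raise a b ≡ (if a <ᵇ b then suc b else if c then suc a else b)
if-⊔-raise c a b with raise-cases a b | c
... | inj₁ (b≤a , r≡b , a≮ᵇb) | true  rewrite r≡b | a≮ᵇb = m≥n⇒m⊔n≡m (m≤n⇒m≤1+n b≤a)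
... | inj₁ (b≤a , r≡b , a≮ᵇb) | false rewrite r≡b | a≮ᵇb = refl
... | inj₂ (a<b , r≡b+1 , a<ᵇb) | true  rewrite r≡b+1 | a<ᵇb = m≤n⇒m⊔n≡n (s≤s (<⇒≤ a<b))
... | inj₂ (a<b , r≡b+1 , a<ᵇb) | false rewrite r≡b+1 | a<ᵇb = refl

⊔-raise : ∀ a b → a ⊔ raise a b ≡ (if a <ᵇ b then suc b else a)
⊔-raise a b with raise-cases a b
... | inj₁ (b≤a , r≡b , a≮ᵇb) rewrite r≡b | a≮ᵇb = m≥n⇒m⊔n≡m b≤a
... | inj₂ (a<b , r≡b+1 , a<ᵇb) rewrite r≡b+1 | a<ᵇb = m≤n⇒m⊔n≡n (≤-trans (<⇒≤ a<b) (n≤1+n _))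

module Prepend (τ : PMPattern 3) (R : Shape) (bound : ∀ {m n} → Vec (Fin m) n → ℕ)
  (match⇔ : ∀ {n} (σ : Perm n) ℓ → T (hasMatchᵇ τ σ ℓ) ⇔ Occurs R σ ℓ)
  (R-punchIn⇔ : ∀ {m} (x : Fin (suc m)) {a b c : Fin m} → R (punchIn x a) (punchIn x b) (punchIn x c) ⇔ R a b c)
  (Follows⇔ : ∀ {m n} (x : Fin m) (t : Vec (Fin m) n) → Follows R x t ⇔ suc (toℕ x) < bound t)
  (bound-punchIn : ∀ {m n} (x : Fin (suc m)) (t : Vec (Fin m) n) → bound (Vec.map (punchIn x) t) ≡ raise (toℕ x) (bound t))
  where

  matchᵇ-prepend : ∀ {n} x (ρ : Perm n) → hasMatchᵇ τ (prepend x ρ) zero ≡ (toℕ x <ᵇ bound ρ)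
  matchᵇ-prepend x ρ = T-injective (begin
    T (hasMatchᵇ τ (prepend x ρ) zero)                  ∼⟨ match⇔ (prepend x ρ) zero ⟩
    Occurs R (prepend x ρ) zero                         ∼⟨ Occurs-head⇔ R x _ ⟩
    Follows R x (Vec.map (punchIn x) ρ)                 ∼⟨ Follows⇔ x _ ⟩
    suc (toℕ x) < bound (Vec.map (punchIn x) ρ)         ≡⟨ cong (suc (toℕ x) <_) (bound-punchIn x ρ) ⟩
    suc (toℕ x) < raise (toℕ x) (bound ρ)               ∼⟨ suc-<-raise⇔ (toℕ x) (bound ρ) ⟩
    toℕ x < bound ρ                                     ∼⟨ ⇔-sym T-<ᵇ ⟩
    T (toℕ x <ᵇ bound ρ)                                ∎)
    where open Related.EquationalReasoning

  pmp-prepend : ∀ {n} x (ρ : Perm n) → pmp τ (prepend x ρ) ≡ (if toℕ x <ᵇ bound ρ then suc (pmp τ ρ) else pmp τ ρ)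
  pmp-prepend x ρ = begin
    pmp τ (prepend x ρ)
      ≡⟨ count-suc (hasMatchᵇ τ (prepend x ρ)) ⟩
    (if hasMatchᵇ τ (prepend x ρ) zero then suc (count (hasMatchᵇ τ (prepend x ρ) ∘ suc))
                                        else count (hasMatchᵇ τ (prepend x ρ) ∘ suc))
      ≡⟨ cong₂ (λ c k → if c then suc k else k) (matchᵇ-prepend x ρ) (count-cong tail⇔) ⟩
    (if toℕ x <ᵇ bound ρ then suc (pmp τ ρ) else pmp τ ρ) ∎
    where
    open ≡-Reasoning
    tail⇔ : ∀ ℓ → T (hasMatchᵇ τ (prepend x ρ) (suc ℓ)) ⇔ T (hasMatchᵇ τ ρ ℓ)
    tail⇔ ℓ = ⇔-trans (match⇔ (prepend x ρ) (suc ℓ))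
              (⇔-trans (Occurs-tail⇔ R x _ ℓ)
              (⇔-trans (Occurs-map⇔ R (punchIn x) (R-punchIn⇔ x) ρ ℓ) (⇔-sym (match⇔ ρ ℓ))))

step123 : ℕ → ℕ × ℕ → ℕ → ℕ × ℕ
step123 n (b , s) x = (if x <ᵇ b then suc b else if x <ᵇ n then suc x else b) , (if x <ᵇ b then suc s else s)

step132 : ℕ → ℕ × ℕ → ℕ → ℕ × ℕ
step132 n (b , s) x = (if x <ᵇ b then suc b else x) , (if x <ᵇ b then suc s else s)

state123 : ∀ {n} → Perm n → ℕ × ℕ
state123 σ = bound123 σ , pmp pat-1̲23 σ

state132 : ∀ {n} → Perm n → ℕ × ℕ
state132 σ = bound132 σ , pmp pat-1̲32 σ

module Prepend-1̲23 = Prepend pat-1̲23 Is123 bound123 hasMatchᵇ-1̲23⇔ Is123-punchIn⇔ Follows-123⇔ bound123-punchIn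

module Prepend-1̲32 = Prepend pat-1̲32 Is132 bound132 hasMatchᵇ-1̲32⇔ Is132-punchIn⇔ Follows-132⇔ bound132-punchIn

state123-prepend : ∀ {n} x {ρ : Perm n} → ρ ∈ S n → state123 (prepend x ρ) ≡ step123 n (state123 ρ) (toℕ x)
state123-prepend {n} x {ρ} ρ∈ = cong₂ _,_ bound≡ (Prepend-1̲23.pmp-prepend x ρ)
  where
  bound≡ : bound123 (prepend x ρ) ≡ proj₁ (step123 n (state123 ρ) (toℕ x))
  bound≡ = trans (cong₂ (λ c v → (if c then suc (toℕ x) else 0) ⊔ v)
                        (hasLarger-prepend x {ρ} (S-surjective ρ∈)) (bound123-punchIn x ρ))
                 (if-⊔-raise (toℕ x <ᵇ n) (toℕ x) (bound123 ρ))

state132-prepend : ∀ {n} x {ρ : Perm n} → ρ ∈ S n → state132 (prepend x ρ) ≡ step132 n (state132 ρ) (toℕ x)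
state132-prepend {n} x {ρ} ρ∈ = cong₂ _,_ bound≡ (Prepend-1̲32.pmp-prepend x ρ)
  where
  bound≡ : bound132 (prepend x ρ) ≡ proj₁ (step132 n (state132 ρ) (toℕ x))
  bound≡ = trans (cong₂ _⊔_ (sucMax-below-prepend x {ρ} (S-surjective ρ∈)) (bound132-punchIn x ρ))
                 (⊔-raise (toℕ x) (bound132 ρ))

-- For x < b both rules give (b + 1, s + 1). On b ≤ x ≤ n the first gives (x + 1, s) for x < n and
-- (b, s) for x = n, the second gives (x, s): the same values, cyclically shifted.
steps-↭ : ∀ n {b} s → b ≤ n → map (step123 n (b , s)) (upTo (suc n)) ↭ map (step132 n (b , s)) (upTo (suc n))
steps-↭ n {b} s b≤n with k , refl ← m≤n⇒∃[o]m+o≡n b≤n = begin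
  map (step123 (b + k) (b , s)) (upTo (suc (b + k)))
    ≡⟨ cong (map _) split ⟩
  map (step123 (b + k) (b , s)) (upTo b ++ applyUpTo (b +_) (suc k))
    ≡⟨ map-++ _ (upTo b) _ ⟩
  map (step123 (b + k) (b , s)) (upTo b) ++ map (step123 (b + k) (b , s)) (applyUpTo (b +_) (suc k))
    ≡⟨ cong₂ _++_ lower upper123 ⟩
  map (step132 (b + k) (b , s)) (upTo b) ++ (shifted ∷ʳ (b , s))
    ↭⟨ ++⁺ˡ _ (↭-sym (∷↭∷ʳ (b , s) shifted)) ⟩
  map (step132 (b + k) (b , s)) (upTo b) ++ ((b , s) ∷ shifted)
    ≡⟨ cong (map (step132 (b + k) (b , s)) (upTo b) ++_) upper132 ⟨
  map (step132 (b + k) (b , s)) (upTo b) ++ map (step132 (b + k) (b , s)) (applyUpTo (b +_) (suc k))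
    ≡⟨ map-++ _ (upTo b) _ ⟨
  map (step132 (b + k) (b , s)) (upTo b ++ applyUpTo (b +_) (suc k))
    ≡⟨ cong (map _) split ⟨
  map (step132 (b + k) (b , s)) (upTo (suc (b + k))) ∎
  where
  open PermutationReasoning
  shifted = applyUpTo (λ i → suc (b + i) , s) k
  split : upTo (suc (b + k)) ≡ upTo b ++ applyUpTo (b +_) (suc k)
  split = trans (cong upTo (sym (+-suc b k))) (applyUpTo-+ id b (suc k))
  lower : map (step123 (b + k) (b , s)) (upTo b) ≡ map (step132 (b + k) (b , s)) (upTo b)
  lower = trans (map-applyUpTo id _ b) (trans (applyUpTo-cong b agree) (sym (map-applyUpTo id _ b)))
    where
    agree : ∀ {i} → i < b → step123 (b + k) (b , s) i ≡ step132 (b + k) (b , s) i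
    agree i<b rewrite <ᵇ-true i<b = refl
  upper123 : map (step123 (b + k) (b , s)) (applyUpTo (b +_) (suc k)) ≡ shifted ∷ʳ (b , s)
  upper123 = trans (map-applyUpTo (b +_) _ (suc k))
                   (trans (sym (applyUpTo-∷ʳ _ k)) (cong₂ _∷ʳ_ (applyUpTo-cong k middle) last))
    where
    middle : ∀ {i} → i < k → step123 (b + k) (b , s) (b + i) ≡ (suc (b + i) , s)
    middle {i} i<k rewrite <ᵇ-false (m≤m+n b i) | <ᵇ-true (+-monoʳ-< b i<k) = refl
    last : step123 (b + k) (b , s) (b + k) ≡ (b , s)
    last rewrite <ᵇ-false (m≤m+n b k) | <ᵇ-false (≤-refl {b + k}) = refl
  upper132 : map (step132 (b + k) (b , s)) (applyUpTo (b +_) (suc k)) ≡ (b , s) ∷ shifted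
  upper132 = trans (map-applyUpTo (b +_) _ (suc k)) (cong₂ _∷_ first (applyUpTo-cong k (λ {i} _ → rest i)))
    where
    first : step132 (b + k) (b , s) (b + 0) ≡ (b , s)
    first rewrite +-identityʳ b | <ᵇ-false (≤-refl {b}) = refl
    rest : ∀ i → step132 (b + k) (b , s) (b + suc i) ≡ (suc (b + i) , s)
    rest i rewrite +-suc b i | <ᵇ-false (m≤n⇒m≤1+n (m≤m+n b i)) = refl

map-state-S-suc : ∀ n (state : ∀ {k} → Perm k → ℕ × ℕ) (step : ℕ × ℕ → ℕ → ℕ × ℕ) →
               (∀ x {ρ} → ρ ∈ S n → state (prepend x ρ) ≡ step (state ρ) (toℕ x)) →
               map state (S (suc n)) ↭ concatMap (λ p → map (step p) (upTo (suc n))) (map state (S n))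
map-state-S-suc n state step state-prepend = begin
  map state (S (suc n))
    ≡⟨ cong (map state) (S-suc n) ⟩
  map state (concatMap (λ x → map (prepend x) (S n)) (allFin (suc n)))
    ≡⟨ map-concatMap state _ (allFin (suc n)) ⟩
  concatMap (λ x → map state (map (prepend x) (S n))) (allFin (suc n))
    ≡⟨ concatMap-cong (λ x → trans (sym (map-∘ (S n))) (map-cong-local (All.tabulate (state-prepend x)))) (allFin (suc n)) ⟩
  concatMap (λ x → map (λ ρ → step (state ρ) (toℕ x)) (S n)) (allFin (suc n))
    ↭⟨ concatMap-swap (λ x ρ → step (state ρ) (toℕ x)) (allFin (suc n)) (S n) ⟩
  concatMap (λ ρ → map (λ x → step (state ρ) (toℕ x)) (allFin (suc n))) (S n)
    ≡⟨ concatMap-cong (λ ρ → map-toℕ-allFin (suc n) (step (state ρ))) (S n) ⟩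
  concatMap (λ ρ → map (step (state ρ)) (upTo (suc n))) (S n)
    ≡⟨ concatMap-map (λ p → map (step p) (upTo (suc n))) state (S n) ⟨
  concatMap (λ p → map (step p) (upTo (suc n))) (map state (S n)) ∎
  where open PermutationReasoning

states-↭ : ∀ n → map state123 (S n) ↭ map state132 (S n)
states-↭ zero    = ↭-refl
states-↭ (suc n) = begin
  map state123 (S (suc n))
    ↭⟨ map-state-S-suc n state123 (step123 n) state123-prepend ⟩
  concatMap (λ p → map (step123 n p) (upTo (suc n))) (map state123 (S n))
    ↭⟨ concatMap-↭ _ (states-↭ n) ⟩
  concatMap (λ p → map (step123 n p) (upTo (suc n))) (map state132 (S n))
    ↭⟨ concatMap-cong-↭ (map state132 (S n)) same-steps ⟩
  concatMap (λ p → map (step132 n p) (upTo (suc n))) (map state132 (S n))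
    ↭⟨ map-state-S-suc n state132 (step132 n) state132-prepend ⟨
  map state132 (S (suc n)) ∎
  where
  open PermutationReasoning
  same-steps : ∀ {p} → p ∈ map state132 (S n) → map (step123 n p) (upTo (suc n)) ↭ map (step132 n p) (upTo (suc n))
  same-steps p∈ with ρ , _ , refl ← ∈-map⁻ state132 p∈ = steps-↭ n (pmp pat-1̲32 ρ) (bound132-≤ ρ)

pmpPolyCoeff-states : ∀ {k} (τ : PMPattern k) (bound : ∀ {n} → Perm n → ℕ) n j →
                      pmpPolyCoeff τ n j ≡ length (filter (λ p → proj₂ p ≟ j) (map (λ σ → bound σ , pmp τ σ) (S n)))
pmpPolyCoeff-states τ bound n j = begin
  length (filter (λ σ → pmp τ σ ≟ j) (S n))               ≡⟨ length-map state (filter (λ σ → pmp τ σ ≟ j) (S n)) ⟨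
  length (map state (filter (λ σ → pmp τ σ ≟ j) (S n)))   ≡⟨ cong length (filter-map (λ p → proj₂ p ≟ j) state (S n)) ⟨
  length (filter (λ p → proj₂ p ≟ j) (map state (S n)))   ∎
  where
  open ≡-Reasoning
  state = λ σ → bound σ , pmp τ σ

theorem1 : (n : ℕ) → 1 ≤ n → pmpWilfEquivAt pat-1̲23 pat-1̲32 n
theorem1 n _ j = begin
  pmpPolyCoeff pat-1̲23 n j
    ≡⟨ pmpPolyCoeff-states pat-1̲23 bound123 n j ⟩
  length (filter (λ p → proj₂ p ≟ j) (map state123 (S n)))
    ≡⟨ ↭-length (filter-↭ (λ p → proj₂ p ≟ j) (states-↭ n)) ⟩
  length (filter (λ p → proj₂ p ≟ j) (map state132 (S n)))
    ≡⟨ pmpPolyCoeff-states pat-1̲32 bound132 n j ⟨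
  pmpPolyCoeff pat-1̲32 n j ∎
  where open ≡-Reasoning
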